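{- Let $G$ be a graph all of whose $\operatorname{IR}(G)$-sets are independent. If the $\operatorname{IR}$-graph $H=G(\operatorname{IR})$ is connected and has order at least three, then $H$ contains a triangle or an induced $C_4$.
   Context: All graphs are finite and simple. For $D\subseteq V(G)$, $v\in D$: $\operatorname{PN}(v,D)=N[v]-N[D-\{v\}]$ (closed neighbourhoods). $D$ is irredundant if $\operatorname{PN}(v,D)\ne\varnothing$ for all $v\in D$; $\operatorname{IR}(G)$ is the max size of an irredundant set; an $\operatorname{IR}(G)$-set is an irredundant set of that size. $G(\operatorname{IR})$ has the $\operatorname{IR}(G)$-sets as vertices, $D\sim D'$ iff $D'=(D-\{u\})\cup\{v\}$ for some $u\in D$, $v\in D'$ with $uv\in E(G)$. -}

module Defs where

open import Data.Nat using (ℕ; _≤_)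
open import Data.Fin using (Fin)
open import Data.Fin.Subset using (Subset; _∈_; _∉_; ∣_∣; _∪_; ⁅_⁆; _─_)
open import Data.Product using (Σ; ∃; ∃-syntax; _×_)
open import Data.Sum using (_⊎_)
open import Relation.Nullary using (¬_; Dec)
open import Relation.Binary.PropositionalEquality using (_≡_; _≢_)
open import Relation.Binary.Construct.Closure.ReflexiveTransitive using (Star)

record Graph (n : ℕ) : Set₁ where
  field
    E      : Fin n → Fin n → Set
    sym    : ∀ {u v} → E u v → E v u
    irrefl : ∀ {v} → ¬ E v v
    dec    : ∀ u v → Dec (E u v)
open Graph public

module _ {n : ℕ} (G : Graph n) where

  InN[_] : Fin n → Fin n → Set
  InN[ v ] w = w ≡ v ⊎ E G v w

  InN[D-v] : Subset n → Fin n → Fin n → Set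
  InN[D-v] D v w = ∃[ u ] (u ∈ D × u ≢ v × InN[ u ] w)

  InPN : Fin n → Subset n → Fin n → Set
  InPN v D w = InN[ v ] w × ¬ InN[D-v] D v w

  Irredundant : Subset n → Set
  Irredundant D = ∀ v → v ∈ D → ∃[ w ] InPN v D w

  IRSet : Subset n → Set
  IRSet D = Irredundant D × (∀ D′ → Irredundant D′ → ∣ D′ ∣ ≤ ∣ D ∣)

  Independent : Subset n → Set
  Independent D = ∀ u v → u ∈ D → v ∈ D → ¬ E G u v

  IRAdj : Subset n → Subset n → Set
  IRAdj D D′ = IRSet D × IRSet D′ ×
    ∃[ u ] ∃[ v ] (u ∈ D × v ∈ D′ × E G u v × D′ ≡ (D ─ ⁅ u ⁆) ∪ ⁅ v ⁆)

  IRConnected : Set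
  IRConnected = ∀ D D′ → IRSet D → IRSet D′ → Star IRAdj D D′

  IROrder≥3 : Set
  IROrder≥3 = ∃[ A ] ∃[ B ] ∃[ C ]
    (IRSet A × IRSet B × IRSet C × A ≢ B × A ≢ C × B ≢ C)

  IRTriangle : Set
  IRTriangle = ∃[ A ] ∃[ B ] ∃[ C ] (IRAdj A B × IRAdj B C × IRAdj A C)

  IRInducedC4 : Set
  IRInducedC4 = ∃[ A ] ∃[ B ] ∃[ C ] ∃[ D ]
    (IRAdj A B × IRAdj B C × IRAdj C D × IRAdj D A ×
     A ≢ B × A ≢ C × A ≢ D × B ≢ C × B ≢ D × C ≢ D ×
     ¬ IRAdj A C × ¬ IRAdj C A × ¬ IRAdj B D × ¬ IRAdj D B)

module Submission where

-- Lemma 4.5.  A connected IR-graph with three vertices contains a path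
-- D₁ - D₂ - D₃ with D₁ ≠ D₃ (a general fact about walks, proved first).
-- Write D₂ = D₁[u ↦ v], D₃ = D₂[x ↦ y]; the sets are independent, so
-- v ∉ D₁ and y ∉ D₂.
--  * x = v: then D₃ = D₁[u ↦ y], and uy is an edge, since otherwise
--    D₁ ∪ {y} would be a larger independent, hence irredundant, set;
--    so D₁ D₂ D₃ is a triangle.
--  * x ≠ v: then x ∈ D₁ and D₄ = D₁[x ↦ y] is irredundant (y, u and the
--    other members have private neighbours x, v and themselves) of size
--    ∣D₁∣, so an IR-set with D₄[u ↦ v] = D₃; D₁ D₂ D₃ D₄ is an induced
--    4-cycle, as opposite sets differ in two elements while an exchange
--    removes only one.

open import Defs hiding (sym)
open import Level using (_⊔_)
open import Data.Nat using (ℕ; suc; _≤_)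
open import Data.Nat.Properties using (1+n≰n)
open import Data.Bool using () renaming (_≟_ to _≟ᵇ_)
open import Data.Fin using (Fin; zero; suc; _≟_)
open import Data.Fin.Subset using (Subset; _∈_; _∉_; _⊆_; ∣_∣; _∪_; _─_; ⁅_⁆; inside; outside)
open import Data.Fin.Subset.Properties
  using (x∈p∪q⁻; x∈p∪q⁺; x∈⁅x⁆; x∈⁅y⁆⇒x≡y; x∈p∧x≢y⇒x∈p-y; p─q⊆p; ∪-identityʳ; p─⊥≡p; ⊆-antisym)
open import Data.Vec using (_∷_; here; there)
open import Data.Vec.Properties using (≡-dec)
open import Data.Product using (∃-syntax; _×_; _,_; proj₁; proj₂)
open import Data.Sum using (_⊎_; inj₁; inj₂)
open import Data.Empty using (⊥-elim)
open import Relation.Nullary using (¬_; yes; no)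
open import Relation.Binary.Core using (Rel)
open import Relation.Binary.Definitions using (DecidableEquality)
open import Relation.Binary.PropositionalEquality
  using (_≡_; _≢_; refl; sym; trans; cong; subst; ≢-sym)
open import Relation.Binary.Construct.Closure.ReflexiveTransitive using (Star; ε; _◅_)

module _ {a ℓ} {A : Set a} (R : Rel A ℓ) where

  TwoPath : Set (a ⊔ ℓ)
  TwoPath = ∃[ X ] ∃[ Y ] ∃[ Z ] (R X Y × R Y Z × X ≢ Z)

  module _ (_≟ᴬ_ : DecidableEquality A) where

    -- After a step Y → X, a walk from X to a vertex outside {Y, X} must at
    -- some point take a step that does not lead back to the previous vertex.
    twoPath-from-walk : ∀ {Y X Z} → R Y X → Star R X Z → Z ≢ Y → Z ≢ X → TwoPath
    twoPath-from-walk _ ε _ Z≢X = ⊥-elim (Z≢X refl)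
    twoPath-from-walk {Y} step (_◅_ {j = X′} next walk) Z≢Y Z≢X with X′ ≟ᴬ Y
    ... | no X′≢Y = _ , _ , _ , step , next , ≢-sym X′≢Y
    ... | yes refl = twoPath-from-walk next walk Z≢X Z≢Y

    twoPath-from-walks : ∀ {X Y Z} → X ≢ Y → X ≢ Z → Y ≢ Z →
                         Star R X Y → Star R Y Z → TwoPath
    twoPath-from-walks X≢Y _ _ ε _ = ⊥-elim (X≢Y refl)
    twoPath-from-walks {Y = Y} X≢Y X≢Z Y≢Z (_◅_ {j = X′} step walk) walkYZ with X′ ≟ᴬ Y
    ... | no X′≢Y = twoPath-from-walk step walk (≢-sym X≢Y) (≢-sym X′≢Y)
    ... | yes refl = twoPath-from-walk step walkYZ (≢-sym X≢Z) (≢-sym Y≢Z)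

x∈p─q⇒x∉q : ∀ {n} (p q : Subset n) {x} → x ∈ p ─ q → x ∉ q
x∈p─q⇒x∉q (_ ∷ p) (outside ∷ q) here ()
x∈p─q⇒x∉q (_ ∷ p) (_ ∷ q) (there x∈) (there x∈q) = x∈p─q⇒x∉q p q x∈ x∈q

∣p∪⁅x⁆∣≡1+∣p∣ : ∀ {n} (p : Subset n) x → x ∉ p → ∣ p ∪ ⁅ x ⁆ ∣ ≡ suc ∣ p ∣
∣p∪⁅x⁆∣≡1+∣p∣ (outside ∷ p) zero _ = cong (λ q → suc ∣ q ∣) (∪-identityʳ p)
∣p∪⁅x⁆∣≡1+∣p∣ (inside ∷ p) zero x∉ = ⊥-elim (x∉ here)
∣p∪⁅x⁆∣≡1+∣p∣ (outside ∷ p) (suc x) x∉ = ∣p∪⁅x⁆∣≡1+∣p∣ p x (λ x∈ → x∉ (there x∈))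
∣p∪⁅x⁆∣≡1+∣p∣ (inside ∷ p) (suc x) x∉ = cong suc (∣p∪⁅x⁆∣≡1+∣p∣ p x (λ x∈ → x∉ (there x∈)))

1+∣p-x∣≡∣p∣ : ∀ {n} (p : Subset n) x → x ∈ p → suc ∣ p ─ ⁅ x ⁆ ∣ ≡ ∣ p ∣
1+∣p-x∣≡∣p∣ (inside ∷ p) zero here = cong (λ q → suc ∣ q ∣) (p─⊥≡p p)
1+∣p-x∣≡∣p∣ (outside ∷ p) (suc x) (there x∈) = 1+∣p-x∣≡∣p∣ p x x∈
1+∣p-x∣≡∣p∣ (inside ∷ p) (suc x) (there x∈) = cong suc (1+∣p-x∣≡∣p∣ p x x∈)

module _ {n : ℕ} where

  infixl 5 _[_↦_]

  _[_↦_] : Subset n → Fin n → Fin n → Subset n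
  D [ u ↦ v ] = (D ─ ⁅ u ⁆) ∪ ⁅ v ⁆

  _≟ˢ_ : DecidableEquality (Subset n)
  _≟ˢ_ = ≡-dec _≟ᵇ_

  ∈-exchange⁻ : ∀ D u v {i} → i ∈ D [ u ↦ v ] → (i ∈ D × i ≢ u) ⊎ i ≡ v
  ∈-exchange⁻ D u v i∈ with x∈p∪q⁻ (D ─ ⁅ u ⁆) ⁅ v ⁆ i∈
  ... | inj₁ i∈D-u = inj₁ (p─q⊆p D ⁅ u ⁆ i∈D-u ,
                           λ { refl → x∈p─q⇒x∉q D ⁅ u ⁆ i∈D-u (x∈⁅x⁆ u) })
  ... | inj₂ i∈⁅v⁆ = inj₂ (x∈⁅y⁆⇒x≡y v i∈⁅v⁆)

  kept : ∀ {D u v i} → i ∈ D → i ≢ u → i ∈ D [ u ↦ v ]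
  kept i∈D i≢u = x∈p∪q⁺ (inj₁ (x∈p∧x≢y⇒x∈p-y i∈D i≢u))

  added : ∀ {D u v} → v ∈ D [ u ↦ v ]
  added {D} {u} {v} = x∈p∪q⁺ {p = D ─ ⁅ u ⁆} (inj₂ (x∈⁅x⁆ v))

  removed : ∀ {D u v} → u ≢ v → u ∉ D [ u ↦ v ]
  removed {D} {u} {v} u≢v u∈ with ∈-exchange⁻ D u v u∈
  ... | inj₁ (_ , u≢u) = u≢u refl
  ... | inj₂ u≡v = u≢v u≡v

  only-named-leaves : ∀ {D u v a} → a ∈ D → a ∉ D [ u ↦ v ] → a ≡ u
  only-named-leaves {u = u} {a = a} a∈D a∉ with a ≟ u
  ... | yes a≡u = a≡u
  ... | no a≢u = ⊥-elim (a∉ (kept a∈D a≢u))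

  differ : ∀ {P Q : Subset n} {a} → a ∈ P → a ∉ Q → P ≢ Q
  differ a∈P a∉Q refl = a∉Q a∈P

  exchange-self : ∀ {D u} → u ∈ D → D [ u ↦ u ] ≡ D
  exchange-self {D} {u} u∈D = ⊆-antisym to from
    where
    to : D [ u ↦ u ] ⊆ D
    to i∈ with ∈-exchange⁻ D u u i∈
    ... | inj₁ (i∈D , _) = i∈D
    ... | inj₂ refl = u∈D
    from : D ⊆ D [ u ↦ u ]
    from {i} i∈D with i ≟ u
    ... | yes refl = added
    ... | no i≢u = kept i∈D i≢u

  exchange-trans : ∀ {D u v y} → v ∉ D → D [ u ↦ v ] [ v ↦ y ] ≡ D [ u ↦ y ]
  exchange-trans {D} {u} {v} {y} v∉D = ⊆-antisym to from
    where
    to : D [ u ↦ v ] [ v ↦ y ] ⊆ D [ u ↦ y ]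
    to i∈ with ∈-exchange⁻ (D [ u ↦ v ]) v y i∈
    ... | inj₂ refl = added
    ... | inj₁ (i∈D₂ , i≢v) with ∈-exchange⁻ D u v i∈D₂
    ...   | inj₁ (i∈D , i≢u) = kept i∈D i≢u
    ...   | inj₂ i≡v = ⊥-elim (i≢v i≡v)
    from : D [ u ↦ y ] ⊆ D [ u ↦ v ] [ v ↦ y ]
    from i∈ with ∈-exchange⁻ D u y i∈
    ... | inj₂ refl = added
    ... | inj₁ (i∈D , i≢u) = kept (kept i∈D i≢u) λ { refl → v∉D i∈D }

  exchange-undo : ∀ {D u v} → u ∈ D → v ∉ D → D [ u ↦ v ] [ v ↦ u ] ≡ D
  exchange-undo u∈D v∉D = trans (exchange-trans v∉D) (exchange-self u∈D)

  exchange-comm : ∀ {D u v x y} → x ≢ v → u ≢ y →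
                  D [ u ↦ v ] [ x ↦ y ] ≡ D [ x ↦ y ] [ u ↦ v ]
  exchange-comm {D} {u} {v} {x} {y} x≢v u≢y = ⊆-antisym (swap-order x≢v u≢y) (swap-order u≢y x≢v)
    where
    swap-order : ∀ {a b c d} → c ≢ b → a ≢ d → D [ a ↦ b ] [ c ↦ d ] ⊆ D [ c ↦ d ] [ a ↦ b ]
    swap-order {a} {b} {c} {d} c≢b a≢d i∈ with ∈-exchange⁻ (D [ a ↦ b ]) c d i∈
    ... | inj₂ refl = kept added (≢-sym a≢d)
    ... | inj₁ (i∈D₂ , i≢c) with ∈-exchange⁻ D a b i∈D₂
    ...   | inj₁ (i∈D , i≢a) = kept (kept i∈D i≢c) i≢a
    ...   | inj₂ refl = added

  ∣exchange∣ : ∀ {D u v} → u ∈ D → v ∉ D → ∣ D [ u ↦ v ] ∣ ≡ ∣ D ∣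
  ∣exchange∣ {D} {u} {v} u∈D v∉D =
    trans (∣p∪⁅x⁆∣≡1+∣p∣ (D ─ ⁅ u ⁆) v (λ v∈ → v∉D (p─q⊆p D ⁅ u ⁆ v∈)))
          (1+∣p-x∣≡∣p∣ D u u∈D)

module _ {n : ℕ} (G : Graph n) where

  HasPrivateNeighbour : Fin n → Subset n → Set
  HasPrivateNeighbour w D = ∃[ p ] InPN G w D p

  private-neighbour : ∀ {D w} p → InN[_] G w p →
                      (∀ z → z ∈ D → z ≢ w → ¬ InN[_] G z p) → HasPrivateNeighbour w D
  private-neighbour p p∈N[w] undominated =
    p , p∈N[w] , λ { (z , z∈D , z≢w , p∈N[z]) → undominated z z∈D z≢w p∈N[z] }

  -- In an independent set every vertex is its own private neighbour.
  independent⇒irredundant : ∀ {D} → Independent G D → Irredundant G D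
  independent⇒irredundant {D} ind w w∈D = private-neighbour w (inj₁ refl) undominated
    where
    undominated : ∀ z → z ∈ D → z ≢ w → ¬ InN[_] G z w
    undominated z _ z≢w (inj₁ w≡z) = z≢w (sym w≡z)
    undominated z z∈D _ (inj₂ zw) = ind z w z∈D w∈D zw

  independent-extension : ∀ {D y} → Independent G D → (∀ a → a ∈ D → ¬ E G a y) →
                          Independent G (D ∪ ⁅ y ⁆)
  independent-extension {D} {y} ind away a b a∈ b∈ ab
    with x∈p∪q⁻ D ⁅ y ⁆ a∈ | x∈p∪q⁻ D ⁅ y ⁆ b∈
  ... | inj₁ a∈D | inj₁ b∈D = ind a b a∈D b∈D ab
  ... | inj₁ a∈D | inj₂ b∈⁅y⁆ rewrite x∈⁅y⁆⇒x≡y y b∈⁅y⁆ = away a a∈D ab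
  ... | inj₂ a∈⁅y⁆ | inj₁ b∈D rewrite x∈⁅y⁆⇒x≡y y a∈⁅y⁆ = away b b∈D (Graph.sym G ab)
  ... | inj₂ a∈⁅y⁆ | inj₂ b∈⁅y⁆
    rewrite x∈⁅y⁆⇒x≡y y a∈⁅y⁆ | x∈⁅y⁆⇒x≡y y b∈⁅y⁆ = Graph.irrefl G ab

  IRSet-maximal : ∀ {D y} → IRSet G D → y ∉ D → ¬ Irredundant G (D ∪ ⁅ y ⁆)
  IRSet-maximal {D} {y} (_ , largest) y∉D irr =
    1+n≰n (subst (_≤ ∣ D ∣) (∣p∪⁅x⁆∣≡1+∣p∣ D y y∉D) (largest _ irr))

  IRSet-same-size : ∀ {D D′} → IRSet G D → Irredundant G D′ → ∣ D′ ∣ ≡ ∣ D ∣ → IRSet G D′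
  IRSet-same-size (_ , largest) irr same = irr , λ D″ irr″ → subst (_ ≤_) (sym same) (largest D″ irr″)

  at-most-one-leaves : ∀ {P Q a b} → IRAdj G P Q → a ∈ P → a ∉ Q → b ∈ P → b ∉ Q → a ≡ b
  at-most-one-leaves (_ , _ , _ , _ , _ , _ , _ , refl) a∈ a∉ b∈ b∉ =
    trans (only-named-leaves a∈ a∉) (sym (only-named-leaves b∈ b∉))

module AllIRSetsIndependent {n : ℕ} (G : Graph n)
  (indep : ∀ (D : Subset n) → IRSet G D → Independent G D) where

  -- G(IR) is undirected: v ∉ D by independence, so D = D[u ↦ v][v ↦ u].
  IRAdj-sym : ∀ {D D′} → IRAdj G D D′ → IRAdj G D′ D
  IRAdj-sym {D} (s , s′ , u , v , u∈D , _ , uv , refl) =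
    s′ , s , v , u , added , u∈D , Graph.sym G uv , sym (exchange-undo u∈D v∉D)
    where
    v∉D : v ∉ D
    v∉D v∈D = indep D s u v u∈D v∈D uv

  -- If D and D[u ↦ y] are IR-sets with y ∉ D, then uy is an edge: otherwise
  -- D ∪ {y} would be a larger independent set.
  exchange-edge : ∀ {D u y} → IRSet G D → IRSet G (D [ u ↦ y ]) → u ∈ D → y ∉ D → E G u y
  exchange-edge {D} {u} {y} s s′ u∈D y∉D with dec G u y
  ... | yes uy = uy
  ... | no ¬uy = ⊥-elim (IRSet-maximal G s y∉D
                   (independent⇒irredundant G (independent-extension G (indep D s) away)))
    where
    away : ∀ a → a ∈ D → ¬ E G a y
    away a a∈D with a ≟ u
    ... | yes refl = ¬uy
    ... | no a≢u = indep _ s′ a y (kept a∈D a≢u) added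

  triangle : ∀ {D u v y} → IRSet G D → IRSet G (D [ u ↦ v ]) → IRSet G (D [ u ↦ v ] [ v ↦ y ]) →
             u ∈ D → E G u v → E G v y → D ≢ D [ u ↦ v ] [ v ↦ y ] → IRTriangle G
  triangle {D} {u} {v} {y} s₁ s₂ s₃ u∈D uv vy D≢D₃ =
    D , _ , _ , (s₁ , s₂ , u , v , u∈D , added , uv , refl) ,
    (s₂ , s₃ , v , y , added , added , vy , refl) ,
    (s₁ , s₃ , u , y , u∈D , added , uy , D₃≡D[u↦y])
    where
    v∉D : v ∉ D
    v∉D v∈D = indep D s₁ u v u∈D v∈D uv
    y∉D₂ : y ∉ D [ u ↦ v ]
    y∉D₂ y∈D₂ = indep _ s₂ v y added y∈D₂ vy
    y∉D : y ∉ D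
    y∉D y∈D with y ≟ u
    ... | yes refl = D≢D₃ (sym (exchange-undo u∈D v∉D))
    ... | no y≢u = y∉D₂ (kept y∈D y≢u)
    D₃≡D[u↦y] : D [ u ↦ v ] [ v ↦ y ] ≡ D [ u ↦ y ]
    D₃≡D[u↦y] = exchange-trans v∉D
    uy : E G u y
    uy = exchange-edge s₁ (subst (IRSet G) D₃≡D[u↦y] s₃) u∈D y∉D

  module FourCycle {D₁ : Subset n} {u v x y : Fin n}
    (s₁ : IRSet G D₁) (s₂ : IRSet G (D₁ [ u ↦ v ])) (s₃ : IRSet G (D₁ [ u ↦ v ] [ x ↦ y ]))
    (u∈₁ : u ∈ D₁) (uv : E G u v) (x∈₂ : x ∈ D₁ [ u ↦ v ]) (xy : E G x y) (x≢v : x ≢ v) where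

    D₂ D₃ D₄ : Subset n
    D₂ = D₁ [ u ↦ v ]
    D₃ = D₂ [ x ↦ y ]
    D₄ = D₁ [ x ↦ y ]

    x∈₁×x≢u : x ∈ D₁ × x ≢ u
    x∈₁×x≢u with ∈-exchange⁻ D₁ u v x∈₂
    ... | inj₁ x∈₁×x≢u = x∈₁×x≢u
    ... | inj₂ x≡v = ⊥-elim (x≢v x≡v)

    x∈₁ : x ∈ D₁
    x∈₁ = proj₁ x∈₁×x≢u

    u≢x : u ≢ x
    u≢x = ≢-sym (proj₂ x∈₁×x≢u)

    x≢y : x ≢ y
    x≢y refl = Graph.irrefl G xy

    v∈₃ : v ∈ D₃
    v∈₃ = kept added (≢-sym x≢v)

    u∈₄ : u ∈ D₄
    u∈₄ = kept u∈₁ u≢x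

    v∉₁ : v ∉ D₁
    v∉₁ v∈ = indep D₁ s₁ u v u∈₁ v∈ uv

    u∉₂ : u ∉ D₂
    u∉₂ u∈ = indep D₂ s₂ u v u∈ added uv

    y∉₁ : y ∉ D₁
    y∉₁ y∈ = indep D₁ s₁ x y x∈₁ y∈ xy

    y∉₂ : y ∉ D₂
    y∉₂ y∈ = indep D₂ s₂ x y x∈₂ y∈ xy

    u≢y : u ≢ y
    u≢y refl = y∉₁ u∈₁

    v≢y : v ≢ y
    v≢y refl = y∉₂ added

    u∉₃ : u ∉ D₃
    u∉₃ u∈ with ∈-exchange⁻ D₂ x y u∈
    ... | inj₁ (u∈₂ , _) = u∉₂ u∈₂
    ... | inj₂ u≡y = u≢y u≡y

    v∉₄ : v ∉ D₄
    v∉₄ v∈ with ∈-exchange⁻ D₁ x y v∈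
    ... | inj₁ (v∈₁ , _) = v∉₁ v∈₁
    ... | inj₂ v≡y = v≢y v≡y

    -- Private neighbours in D₄: x for y, v for u, and itself for any other w.
    y-private : HasPrivateNeighbour G y D₄
    y-private = private-neighbour G x (inj₂ (Graph.sym G xy)) undominated
      where
      undominated : ∀ z → z ∈ D₄ → z ≢ y → ¬ InN[_] G z x
      undominated z z∈ z≢y x∈N[z] with ∈-exchange⁻ D₁ x y z∈ | x∈N[z]
      ... | inj₂ z≡y | _ = z≢y z≡y
      ... | inj₁ (_ , z≢x) | inj₁ x≡z = z≢x (sym x≡z)
      ... | inj₁ (z∈₁ , _) | inj₂ zx = indep D₁ s₁ z x z∈₁ x∈₁ zx

    u-private : HasPrivateNeighbour G u D₄
    u-private = private-neighbour G v (inj₂ uv) undominated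
      where
      undominated : ∀ z → z ∈ D₄ → z ≢ u → ¬ InN[_] G z v
      undominated z z∈ z≢u v∈N[z] with ∈-exchange⁻ D₁ x y z∈ | v∈N[z]
      ... | inj₁ (z∈₁ , _) | inj₁ refl = v∉₁ z∈₁
      ... | inj₁ (z∈₁ , _) | inj₂ zv = indep D₂ s₂ z v (kept z∈₁ z≢u) added zv
      ... | inj₂ refl | inj₁ v≡y = v≢y v≡y
      ... | inj₂ refl | inj₂ yv = indep D₃ s₃ y v added v∈₃ yv

    other-private : ∀ w → w ∈ D₁ → w ≢ x → w ≢ u → HasPrivateNeighbour G w D₄
    other-private w w∈₁ w≢x w≢u = private-neighbour G w (inj₁ refl) undominated
      where
      undominated : ∀ z → z ∈ D₄ → z ≢ w → ¬ InN[_] G z w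
      undominated z _ z≢w (inj₁ w≡z) = z≢w (sym w≡z)
      undominated z z∈ _ (inj₂ zw) with ∈-exchange⁻ D₁ x y z∈
      ... | inj₁ (z∈₁ , _) = indep D₁ s₁ z w z∈₁ w∈₁ zw
      ... | inj₂ refl = indep D₃ s₃ y w added (kept (kept w∈₁ w≢u) w≢x) zw

    D₄-irredundant : Irredundant G D₄
    D₄-irredundant w w∈ with ∈-exchange⁻ D₁ x y w∈
    ... | inj₂ refl = y-private
    ... | inj₁ (w∈₁ , w≢x) with w ≟ u
    ...   | yes refl = u-private
    ...   | no w≢u = other-private w w∈₁ w≢x w≢u

    s₄ : IRSet G D₄
    s₄ = IRSet-same-size G s₁ D₄-irredundant (∣exchange∣ x∈₁ y∉₁)

    no-edge : ∀ {P Q a b} → a ≢ b → a ∈ P → a ∉ Q → b ∈ P → b ∉ Q → ¬ IRAdj G P Q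
    no-edge a≢b a∈ a∉ b∈ b∉ PQ = a≢b (at-most-one-leaves G PQ a∈ a∉ b∈ b∉)

    ¬D₁~D₃ : ¬ IRAdj G D₁ D₃
    ¬D₁~D₃ = no-edge u≢x u∈₁ u∉₃ x∈₁ (removed x≢y)

    ¬D₂~D₄ : ¬ IRAdj G D₂ D₄
    ¬D₂~D₄ = no-edge x≢v x∈₂ (removed x≢y) added v∉₄

    cycle : IRInducedC4 G
    cycle =
      D₁ , D₂ , D₃ , D₄ ,
      (s₁ , s₂ , u , v , u∈₁ , added , uv , refl) ,
      (s₂ , s₃ , x , y , x∈₂ , added , xy , refl) ,
      IRAdj-sym (s₄ , s₃ , u , v , u∈₄ , v∈₃ , uv , exchange-comm x≢v u≢y) ,
      IRAdj-sym (s₁ , s₄ , x , y , x∈₁ , added , xy , refl) ,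
      ≢-sym (differ added v∉₁) , differ u∈₁ u∉₃ , ≢-sym (differ added y∉₁) ,
      ≢-sym (differ added y∉₂) , ≢-sym (differ u∈₄ u∉₂) , ≢-sym (differ u∈₄ u∉₃) ,
      ¬D₁~D₃ , (λ D₃~D₁ → ¬D₁~D₃ (IRAdj-sym D₃~D₁)) ,
      ¬D₂~D₄ , (λ D₄~D₂ → ¬D₂~D₄ (IRAdj-sym D₄~D₂))

  twoPath⇒triangle-or-C4 : TwoPath (IRAdj G) → IRTriangle G ⊎ IRInducedC4 G
  twoPath⇒triangle-or-C4
    (D₁ , _ , _ , (s₁ , s₂ , u , v , u∈₁ , _ , uv , refl) , (_ , s₃ , x , y , x∈₂ , _ , xy , refl) , D₁≢D₃)
    with x ≟ v
  ... | yes refl = inj₁ (triangle s₁ s₂ s₃ u∈₁ uv xy D₁≢D₃)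
  ... | no x≢v = inj₂ (FourCycle.cycle s₁ s₂ s₃ u∈₁ uv x∈₂ xy x≢v)

lemma4p5 : (n : ℕ) (G : Graph n) →
    (∀ (D : Subset n) → IRSet G D → Independent G D) →
    IRConnected G → IROrder≥3 G →
    IRTriangle G ⊎ IRInducedC4 G
lemma4p5 n G indep connected (A , B , C , sA , sB , sC , A≢B , A≢C , B≢C) =
  twoPath⇒triangle-or-C4
    (twoPath-from-walks (IRAdj G) _≟ˢ_ A≢B A≢C B≢C
      (connected A B sA sB) (connected B C sB sC))
  where open AllIRSetsIndependent G indep
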